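{- Let $m\geq 5$ be an odd integer and $n\geq 4$ an even integer. Then $\chi_{lid}(C_m\square C_n)=4$.
   Context: $C_n$ denotes the cycle on $n$ vertices. A proper $k$-coloring of a graph $G$ is a map $f:V(G)\to\{1,\dots,k\}$ with $f(u)\neq f(v)$ for every edge $uv$. For a vertex $v$, $N[v]$ denotes its closed neighborhood, and $f(S)=\{f(x):x\in S\}$. A lid-coloring of $G$ is a proper coloring $f$ such that for every edge $uv$ with $N[u]\neq N[v]$ we have $f(N[u])\neq f(N[v])$; $\chi_{lid}(G)$ is the smallest number of colors in a lid-coloring of $G$. The Cartesian product $G\square H$ has vertex set $V(G)\times V(H)$, where $(u_1,v_1)$ and $(u_2,v_2)$ are adjacent iff either $u_1=u_2$ and $v_1v_2\in E(H)$, or $v_1=v_2$ and $u_1u_2\in E(G)$. -}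

module Defs where

open import Data.Nat using (ℕ; zero; suc; _<_)
open import Data.Fin using (Fin; toℕ)
open import Data.Product using (Σ; _×_; ∃)
open import Data.Sum using (_⊎_)
open import Relation.Binary.PropositionalEquality using (_≡_; _≢_)
open import Relation.Nullary using (¬_)
open import Function.Bundles using (_⇔_)

record Graph : Set₁ where
  field
    V   : Set
    Adj : V → V → Set
open Graph public

CycSucc : (m : ℕ) → Fin m → Fin m → Set
CycSucc m i j = (suc (toℕ i) ≡ toℕ j) ⊎ ((suc (toℕ i) ≡ m) × (toℕ j ≡ 0))

Cycle : ℕ → Graph
Cycle m = record { V = Fin m ; Adj = λ i j → CycSucc m i j ⊎ CycSucc m j i }

_□_ : Graph → Graph → Graph
G □ H = record
  { V   = V G × V H
  ; Adj = λ p q → ((Data.Product.proj₁ p ≡ Data.Product.proj₁ q) × Adj H (Data.Product.proj₂ p) (Data.Product.proj₂ q))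
                ⊎ ((Data.Product.proj₂ p ≡ Data.Product.proj₂ q) × Adj G (Data.Product.proj₁ p) (Data.Product.proj₁ q))
  }

N[_]∋_ : {G : Graph} → V G → V G → Set
N[_]∋_ {G} v x = (x ≡ v) ⊎ Adj G v x

SameN : (G : Graph) → V G → V G → Set
SameN G u v = ∀ x → (N[_]∋_ {G} u x) ⇔ (N[_]∋_ {G} v x)

ColorIn : (G : Graph) {k : ℕ} → (V G → Fin k) → V G → Fin k → Set
ColorIn G f v c = ∃ λ x → N[_]∋_ {G} v x × f x ≡ c

SameColors : (G : Graph) {k : ℕ} → (V G → Fin k) → V G → V G → Set
SameColors G f u v = ∀ c → ColorIn G f u c ⇔ ColorIn G f v c

Proper : (G : Graph) {k : ℕ} → (V G → Fin k) → Set
Proper G f = ∀ u v → Adj G u v → f u ≢ f v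

IsLidColoring : (G : Graph) (k : ℕ) → (V G → Fin k) → Set
IsLidColoring G k f =
  Proper G f ×
  (∀ u v → Adj G u v → ¬ SameN G u v → ¬ SameColors G f u v)

χlid≡ : Graph → ℕ → Set
χlid≡ G k = (Σ (V G → Fin k) (IsLidColoring G k))
          × (∀ j → j < k → (f : V G → Fin j) → ¬ IsLidColoring G j f)

-- A lid-colouring of C_m □ C_n is proper on the odd cycle C_m × {0}, so it needs
-- three colours. With exactly three colours, adjacent u, v have f(N[u]) = f(N[v]) whenever both
-- neighbourhoods see all colours, and also whenever both miss one, since then both sets are
-- {f u, f v}. So "N[v] sees all three colours" would have to alternate around the odd cycle.
--
-- Each column {i} × C_n alternates between the two colours of a stripe, and the
-- stripes around C_m read E D C B A B A … B A. The colours of N[(i, j)] depend only on the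
-- stripes at i - 1, i, i + 1 and the parity of j, so the lid condition reduces to finitely many
-- windows of consecutive stripes, which are checked by evaluation.
module Submission where

open import Defs
open import Data.Nat as ℕ using (ℕ; zero; suc; _≤_; _<_; _%_; s≤s; z≤n; parity)
open import Data.Nat.Properties using (0≢1+n; 1+n≢n; suc-injective; <⇒≢; ≤-refl; ≤-trans; n≤1+n)
open import Data.Fin using (Fin; zero; suc; toℕ; fromℕ; inject₁; lower₁; punchOut)
open import Data.Fin.Patterns using (0F; 1F; 2F; 3F)
open import Data.Fin.Properties
  using (_≟_; toℕ-injective; toℕ<n; toℕ-fromℕ; toℕ-inject₁; toℕ-lower₁; punchOut-injective;
         any?; all?; ¬Fin0)
open import Data.Parity.Base using (Parity; 0ℙ; 1ℙ; _⁻¹)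
open import Data.Parity.Properties using (⁻¹-selfInverse; suc-homo-⁻¹)
open import Data.Bool using (Bool)
open import Data.Bool.Properties using (¬-not)
open import Data.Product using (_×_; _,_; proj₂; ∃)
open import Data.Sum using (_⊎_; inj₁; inj₂; swap)
open import Data.List using (List; []; _∷_; map)
import Data.List.Relation.Unary.Any as Any
open import Data.List.Relation.Unary.Any using (here; there)
open import Data.List.Membership.Propositional using (_∈_; _∉_)
open import Data.List.Membership.Propositional.Properties using (∈-map⁺; ∈-map⁻)
open import Relation.Binary.PropositionalEquality
open import Relation.Nullary using (¬_; Dec; yes; no; contradiction)
open import Relation.Nullary.Decidable
  using (isYes; True; toWitness; map′; ¬?; _×-dec_; _⊎-dec_)
open import Function using (_∘_)
open import Function.Bundles using (_⇔_; mk⇔; Equivalence)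
import Function.Properties.Equivalence as Equiv

CycSucc-functional : ∀ {M} {i j k : Fin M} → CycSucc M i j → CycSucc M i k → j ≡ k
CycSucc-functional (inj₁ i→j) (inj₁ i→k) = toℕ-injective (trans (sym i→j) i→k)
CycSucc-functional (inj₁ i→j) (inj₂ (i≡last , _)) =
  contradiction (trans (sym i→j) i≡last) (<⇒≢ (toℕ<n _))
CycSucc-functional (inj₂ (i≡last , _)) (inj₁ i→k) =
  contradiction (trans (sym i→k) i≡last) (<⇒≢ (toℕ<n _))
CycSucc-functional (inj₂ (_ , j≡0)) (inj₂ (_ , k≡0)) = toℕ-injective (trans j≡0 (sym k≡0))

CycSucc-injective : ∀ {M} {i j k : Fin M} → CycSucc M i k → CycSucc M j k → i ≡ j
CycSucc-injective (inj₁ i→k) (inj₁ j→k) = toℕ-injective (suc-injective (trans i→k (sym j→k)))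
CycSucc-injective (inj₁ i→k) (inj₂ (_ , k≡0)) = contradiction (trans i→k k≡0) λ ()
CycSucc-injective (inj₂ (_ , k≡0)) (inj₁ j→k) = contradiction (trans j→k k≡0) λ ()
CycSucc-injective (inj₂ (i≡last , _)) (inj₂ (j≡last , _)) =
  toℕ-injective (suc-injective (trans i≡last (sym j≡last)))

CycSucc-irrefl : ∀ {m} (i : Fin (suc (suc m))) → ¬ CycSucc (suc (suc m)) i i
CycSucc-irrefl i (inj₁ i→i)            = 1+n≢n i→i
CycSucc-irrefl i (inj₂ (i≡last , i≡0)) = 0≢1+n (suc-injective (trans (sym (cong suc i≡0)) i≡last))

module _ {m : ℕ} where

  next : Fin (suc m) → Fin (suc m)
  next i with m ℕ.≟ toℕ i
  ... | yes _   = zero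
  ... | no m≢i = suc (lower₁ i m≢i)

  prev : Fin (suc m) → Fin (suc m)
  prev zero    = fromℕ m
  prev (suc i) = inject₁ i

  CycSucc-next : ∀ i → CycSucc (suc m) i (next i)
  CycSucc-next i with m ℕ.≟ toℕ i
  ... | yes m≡i = inj₂ (cong suc (sym m≡i) , refl)
  ... | no m≢i  = inj₁ (cong suc (sym (toℕ-lower₁ i m≢i)))

  CycSucc-prev : ∀ i → CycSucc (suc m) (prev i) i
  CycSucc-prev zero    = inj₂ (cong suc (toℕ-fromℕ m) , refl)
  CycSucc-prev (suc i) = inj₁ (cong suc (toℕ-inject₁ i))

  next-prev : ∀ i → next (prev i) ≡ i
  next-prev i = CycSucc-functional (CycSucc-next (prev i)) (CycSucc-prev i)

  prev-next : ∀ i → prev (next i) ≡ i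
  prev-next i = CycSucc-injective (CycSucc-prev (next i)) (CycSucc-next i)

  Cycle-adj : ∀ {i j} → Adj (Cycle (suc m)) i j → j ≡ next i ⊎ j ≡ prev i
  Cycle-adj (inj₁ i→j) = inj₁ (CycSucc-functional i→j (CycSucc-next _))
  Cycle-adj (inj₂ j→i) = inj₂ (CycSucc-injective j→i (CycSucc-prev _))

  along-next : {A : Set} (R : A → A → Set) (g : ℕ → A) →
               (∀ k → R (g k) (g (suc k))) → R (g m) (g 0) →
               ∀ i → R (g (toℕ i)) (g (toℕ (next i)))
  along-next R g step wrap i with CycSucc-next i
  ... | inj₁ i→next              = subst (R (g (toℕ i)) ∘ g) i→next (step (toℕ i))
  ... | inj₂ (i≡last , next≡0) =
    subst₂ (λ s t → R (g s) (g t)) (sym (suc-injective i≡last)) (sym next≡0) wrap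

  walk : ℕ → Fin (suc m)
  walk zero    = zero
  walk (suc k) = next (walk k)

  toℕ-walk : ∀ k → k ≤ m → toℕ (walk k) ≡ k
  toℕ-walk zero    _   = refl
  toℕ-walk (suc k) k<m with toℕ-walk k (≤-trans (n≤1+n k) k<m) | CycSucc-next (walk k)
  ... | w≡k | inj₁ w→next        = trans (sym w→next) (cong suc w≡k)
  ... | w≡k | inj₂ (w≡last , _) =
    contradiction (suc-injective (trans (sym (cong suc w≡k)) w≡last)) (<⇒≢ k<m)

  next-walk-last : next (walk m) ≡ zero
  next-walk-last = begin
    next (walk m)     ≡⟨ cong next (toℕ-injective (trans (toℕ-walk m ≤-refl) (sym (toℕ-fromℕ m)))) ⟩
    next (prev zero)  ≡⟨ next-prev zero ⟩
    zero              ∎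
    where open ≡-Reasoning

next-≢ : ∀ {m} (i : Fin (suc (suc m))) → next i ≢ i
next-≢ i next≡i = CycSucc-irrefl i (subst (CycSucc _ i) next≡i (CycSucc-next i))

TwoValued : Set → Set
TwoValued A = ∀ {x y z : A} → x ≢ y → z ≢ y → x ≡ z

odd-cycle-not-alternating : ∀ {m} {A : Set} → TwoValued A → suc m % 2 ≡ 1 →
                            (h : Fin (suc m) → A) → ¬ (∀ i → h i ≢ h (next i))
odd-cycle-not-alternating {m} two odd h alt =
  alt (walk m) (trans (h-walk-even m odd) (cong h (sym next-walk-last)))
  where
  h-walk-even : ∀ k → suc k % 2 ≡ 1 → h (walk k) ≡ h zero
  h-walk-even zero          _     = refl
  h-walk-even (suc zero)    ()
  h-walk-even (suc (suc k)) odd-k =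
    trans (two (alt (walk (suc k)) ∘ sym) (alt (walk k))) (h-walk-even k odd-k)

Bool-twoValued : TwoValued Bool
Bool-twoValued x≢y z≢y = trans (¬-not x≢y) (sym (¬-not z≢y))

Fin1-unique : (x y : Fin 1) → x ≡ y
Fin1-unique zero zero = refl

Fin2-twoValued : TwoValued (Fin 2)
Fin2-twoValued x≢y z≢y = punchOut-injective (x≢y ∘ sym) (z≢y ∘ sym) (Fin1-unique _ _)

Fin3-third-unique : ∀ {x y c d : Fin 3} → x ≢ y → c ≢ x → c ≢ y → d ≢ x → d ≢ y → c ≡ d
Fin3-third-unique {x} {y} x≢y c≢x c≢y d≢x d≢y =
  punchOut-injective (c≢x ∘ sym) (d≢x ∘ sym) (Fin2-twoValued (punched-≢ c≢x c≢y) (punched-≢ d≢x d≢y))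
  where
  punched-≢ : ∀ {z} (z≢x : z ≢ x) → z ≢ y → punchOut (z≢x ∘ sym) ≢ punchOut x≢y
  punched-≢ z≢x z≢y = z≢y ∘ punchOut-injective (z≢x ∘ sym) x≢y

Undirected : Graph → Set
Undirected G = ∀ {u v} → Adj G u v → Adj G v u

Cycle-undirected : ∀ {m} → Undirected (Cycle m)
Cycle-undirected = swap

□-undirected : ∀ {G H} → Undirected G → Undirected H → Undirected (G □ H)
□-undirected _    symH (inj₁ (u≡v , a)) = inj₁ (sym u≡v , symH a)
□-undirected symG _    (inj₂ (u≡v , a)) = inj₂ (sym u≡v , symG a)

module _ (G : Graph) {k : ℕ} (f : V G → Fin k) where

  own-colour : ∀ v → ColorIn G f v (f v)
  own-colour v = v , inj₁ refl , refl

  neighbour-colour : ∀ {u v} → Adj G u v → ColorIn G f u (f v)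
  neighbour-colour {v = v} u~v = v , inj₂ u~v , refl

  SeesAllColours : V G → Set
  SeesAllColours v = ∀ c → ColorIn G f v c

module _ (G : Graph) (undirected : Undirected G) (f : V G → Fin 3) where

  private
    All = SeesAllColours G f

  ¬seesAll⇒edge-colours : ∀ {u v c} → Adj G u v → f u ≢ f v → ¬ All u →
                          ColorIn G f u c → c ≡ f u ⊎ c ≡ f v
  ¬seesAll⇒edge-colours {u} {v} {c} u~v fu≢fv ¬all c∈Nu with c ≟ f u | c ≟ f v
  ... | yes c≡fu | _         = inj₁ c≡fu
  ... | no _     | yes c≡fv = inj₂ c≡fv
  ... | no c≢fu  | no c≢fv  = contradiction all ¬all
    where
    all : All u
    all d with d ≟ f u | d ≟ f v
    ... | yes refl | _        = own-colour G f u
    ... | no _     | yes refl = neighbour-colour G f u~v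
    ... | no d≢fu  | no d≢fv  =
      subst (ColorIn G f u) (Fin3-third-unique fu≢fv c≢fu c≢fv d≢fu d≢fv) c∈Nu

  sameColors-if-neither-sees-all : ∀ {u v} → Adj G u v → f u ≢ f v → ¬ All u → ¬ All v →
                                   SameColors G f u v
  sameColors-if-neither-sees-all u~v fu≢fv ¬all-u ¬all-v c =
    mk⇔ (transfer u~v fu≢fv ¬all-u) (transfer (undirected u~v) (fu≢fv ∘ sym) ¬all-v)
    where
    transfer : ∀ {u v} → Adj G u v → f u ≢ f v → ¬ All u → ColorIn G f u c → ColorIn G f v c
    transfer u~v fu≢fv ¬all c∈Nu with ¬seesAll⇒edge-colours u~v fu≢fv ¬all c∈Nu
    ... | inj₁ refl = neighbour-colour G f (undirected u~v)
    ... | inj₂ refl = own-colour G f _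

  lid3⇒seesAll-differs : (all? : ∀ v → Dec (All v)) → IsLidColoring G 3 f →
                         ∀ {u v} → Adj G u v → ¬ SameN G u v →
                         isYes (all? u) ≢ isYes (all? v)
  lid3⇒seesAll-differs all? (proper , lid) {u} {v} u~v ≠N with all? u | all? v
  ... | yes all-u | yes all-v = λ _ → lid u v u~v ≠N λ c → mk⇔ (λ _ → all-v c) (λ _ → all-u c)
  ... | yes _     | no _      = λ ()
  ... | no _      | yes _     = λ ()
  ... | no ¬all-u | no ¬all-v =
    λ _ → lid u v u~v ≠N (sameColors-if-neither-sees-all u~v (proper u v u~v) ¬all-u ¬all-v)

Distinguishable : ∀ {k} → List (Fin k) → List (Fin k) → Set
Distinguishable xs ys = ∃ λ c → c ∈ xs × c ∉ ys ⊎ c ∈ ys × c ∉ xs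

distinguishable? : ∀ {k} (xs ys : List (Fin k)) → Dec (Distinguishable xs ys)
distinguishable? xs ys =
  any? λ c → (c ∈? xs ×-dec ¬? (c ∈? ys)) ⊎-dec (c ∈? ys ×-dec ¬? (c ∈? xs))
  where
  _∈?_ : ∀ {k} (c : Fin k) xs → Dec (c ∈ xs)
  c ∈? xs = Any.any? (c ≟_) xs

distinguish : ∀ {k} {xs ys : List (Fin k)} → True (distinguishable? xs ys) → Distinguishable xs ys
distinguish = toWitness

module _ (G : Graph) (nbrs : V G → List (V G))
         (nbrs-spec : ∀ v x → N[_]∋_ {G} v x ⇔ x ∈ nbrs v) {k : ℕ} (f : V G → Fin k) where

  colorIn⇒∈ : ∀ {v c} → ColorIn G f v c → c ∈ map f (nbrs v)
  colorIn⇒∈ {v} (x , x∈Nv , refl) = ∈-map⁺ f (Equivalence.to (nbrs-spec v x) x∈Nv)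

  ∈⇒colorIn : ∀ {v c} → c ∈ map f (nbrs v) → ColorIn G f v c
  ∈⇒colorIn {v} c∈ with ∈-map⁻ f c∈
  ... | x , x∈nbrs , refl = x , Equivalence.from (nbrs-spec v x) x∈nbrs , refl

  colorIn? : ∀ v c → Dec (ColorIn G f v c)
  colorIn? v c = map′ ∈⇒colorIn colorIn⇒∈ (Any.any? (c ≟_) (map f (nbrs v)))

  distinguishable⇒¬sameColors : ∀ {u v} → Distinguishable (map f (nbrs u)) (map f (nbrs v)) →
                                ¬ SameColors G f u v
  distinguishable⇒¬sameColors (c , inj₁ (c∈u , c∉v)) same =
    c∉v (colorIn⇒∈ (Equivalence.to (same c) (∈⇒colorIn c∈u)))
  distinguishable⇒¬sameColors (c , inj₂ (c∈v , c∉u)) same =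
    c∉u (colorIn⇒∈ (Equivalence.from (same c) (∈⇒colorIn c∈v)))

Torus : ℕ → ℕ → Graph
Torus m n = Cycle (suc m) □ Cycle (suc n)

Torus-undirected : ∀ {m n} → Undirected (Torus m n)
Torus-undirected = □-undirected Cycle-undirected Cycle-undirected

module _ {m n : ℕ} where

  private
    G = Torus m n

  open-nbrs : V G → List (V G)
  open-nbrs (i , j) = (i , next j) ∷ (i , prev j) ∷ (next i , j) ∷ (prev i , j) ∷ []

  nbrs : V G → List (V G)
  nbrs u = u ∷ open-nbrs u

  adj⇒∈open-nbrs : ∀ {u x} → Adj G u x → x ∈ open-nbrs u
  adj⇒∈open-nbrs (inj₁ (refl , j~j′)) with Cycle-adj j~j′
  ... | inj₁ refl = here refl
  ... | inj₂ refl = there (here refl)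
  adj⇒∈open-nbrs (inj₂ (refl , i~i′)) with Cycle-adj i~i′
  ... | inj₁ refl = there (there (here refl))
  ... | inj₂ refl = there (there (there (here refl)))

  ∈open-nbrs⇒adj : ∀ {u x} → x ∈ open-nbrs u → Adj G u x
  ∈open-nbrs⇒adj (here refl)                         = inj₁ (refl , inj₁ (CycSucc-next _))
  ∈open-nbrs⇒adj (there (here refl))                 = inj₁ (refl , inj₂ (CycSucc-prev _))
  ∈open-nbrs⇒adj (there (there (here refl)))         = inj₂ (refl , inj₁ (CycSucc-next _))
  ∈open-nbrs⇒adj (there (there (there (here refl)))) = inj₂ (refl , inj₂ (CycSucc-prev _))

  nbrs-spec : ∀ u x → N[_]∋_ {G} u x ⇔ x ∈ nbrs u
  nbrs-spec u x = mk⇔ to from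
    where
    to : N[_]∋_ {G} u x → x ∈ nbrs u
    to (inj₁ x≡u) = here x≡u
    to (inj₂ u~x) = there (adj⇒∈open-nbrs u~x)
    from : x ∈ nbrs u → N[_]∋_ {G} u x
    from (here x≡u)  = inj₁ x≡u
    from (there x∈) = inj₂ (∈open-nbrs⇒adj x∈)

  edge-ind : (Q : V G → V G → Set) → (∀ {u v} → Q u v → Q v u) →
             (∀ i j → Q (i , j) (i , next j)) → (∀ i j → Q (i , j) (next i , j)) →
             ∀ {u v} → Adj G u v → Q u v
  edge-ind Q sym-Q vertical horizontal {i , j} u~v with adj⇒∈open-nbrs u~v
  ... | here refl                         = vertical i j
  ... | there (here refl)                 =
    subst (λ j′ → Q (i , j′) (i , prev j)) (next-prev j) (sym-Q (vertical i (prev j)))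
  ... | there (there (here refl))         = horizontal i j
  ... | there (there (there (here refl))) =
    subst (λ i′ → Q (i′ , j) (prev i , j)) (next-prev i) (sym-Q (horizontal (prev i) j))

module _ {m n : ℕ} where

  private
    G = Torus (suc m) (suc n)

  row-edge : ∀ i → Adj G (i , zero) (next i , zero)
  row-edge i = inj₂ (refl , inj₁ (CycSucc-next i))

  row-edge-¬sameN : ∀ i → ¬ SameN G (i , zero) (next i , zero)
  row-edge-¬sameN i same
    with Equivalence.to (same (i , next zero)) (inj₂ (inj₁ (refl , inj₁ (CycSucc-next zero))))
  ... | inj₁ eq                         = next-≢ zero (cong proj₂ eq)
  ... | inj₂ (inj₁ (next-i≡i , _))     = next-≢ i next-i≡i
  ... | inj₂ (inj₂ (0≡next-0 , _))     = next-≢ zero (sym 0≡next-0)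

  no-lid-colouring-below-4 : suc (suc m) % 2 ≡ 1 →
                             ∀ k → k < 4 → (f : V G → Fin k) → ¬ IsLidColoring G k f
  no-lid-colouring-below-4 _   0 _ f _ = ¬Fin0 (f (zero , zero))
  no-lid-colouring-below-4 _   1 _ f (proper , _) = proper _ _ (row-edge zero) (Fin1-unique _ _)
  no-lid-colouring-below-4 odd 2 _ f (proper , _) =
    odd-cycle-not-alternating Fin2-twoValued odd (λ i → f (i , zero)) (λ i → proper _ _ (row-edge i))
  no-lid-colouring-below-4 odd 3 _ f lid =
    odd-cycle-not-alternating Bool-twoValued odd (λ i → isYes (sees-all? (i , zero))) λ i →
      lid3⇒seesAll-differs G Torus-undirected f sees-all? lid (row-edge i) (row-edge-¬sameN i)
    where
    sees-all? : ∀ v → Dec (SeesAllColours G f v)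
    sees-all? v = all? (colorIn? G nbrs nbrs-spec f v)
  no-lid-colouring-below-4 _ (suc (suc (suc (suc _)))) (s≤s (s≤s (s≤s (s≤s ()))))

parity-suc : ∀ k → parity (suc k) ≡ parity k ⁻¹
parity-suc k = sym (⁻¹-selfInverse (suc-homo-⁻¹ k))

parity-pred-even : ∀ k → suc k % 2 ≡ 0 → parity k ≡ 1ℙ
parity-pred-even zero          ()
parity-pred-even (suc zero)    _     = refl
parity-pred-even (suc (suc k)) even = parity-pred-even k even

data Stripe : Set where
  A B C D E : Stripe

data _↝_ : Stripe → Stripe → Set where
  E↝D : E ↝ D
  D↝C : D ↝ C
  C↝B : C ↝ B
  B↝A : B ↝ A
  A↝B : A ↝ B
  A↝E : A ↝ E

stripe : ℕ → Stripe
stripe 0 = E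
stripe 1 = D
stripe 2 = C
stripe 3 = B
stripe 4 = A
stripe (suc (suc (suc (suc (suc k))))) = stripe (suc (suc (suc k)))

stripe-step : ∀ k → stripe k ↝ stripe (suc k)
stripe-step 0 = E↝D
stripe-step 1 = D↝C
stripe-step 2 = C↝B
stripe-step 3 = B↝A
stripe-step 4 = A↝B
stripe-step (suc (suc (suc (suc (suc k))))) = stripe-step (suc (suc (suc k)))

stripe-even : ∀ k → suc k % 2 ≡ 1 → 4 ≤ k → stripe k ≡ A
stripe-even 0 _  ()
stripe-even 1 () _
stripe-even 2 _  (s≤s (s≤s ()))
stripe-even 3 () _
stripe-even 4 _  _ = refl
stripe-even 5 () _
stripe-even (suc (suc (suc (suc (suc (suc k)))))) odd _ =
  stripe-even (suc (suc (suc (suc k)))) odd (s≤s (s≤s (s≤s (s≤s z≤n))))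

colour : Stripe → Parity → Fin 4
colour A 0ℙ = 0F
colour A 1ℙ = 1F
colour B 0ℙ = 1F
colour B 1ℙ = 2F
colour C 0ℙ = 0F
colour C 1ℙ = 3F
colour D 0ℙ = 3F
colour D 1ℙ = 2F
colour E 0ℙ = 1F
colour E 1ℙ = 3F

-- The colours of N[(i, j)], listed as nbrs lists the vertices, when prev i, i, next i carry the
-- stripes a, b, c and j has parity p (both neighbours of j along C_n have the other parity).
window : Stripe → Stripe → Stripe → Parity → List (Fin 4)
window a b c p = colour b p ∷ colour b (p ⁻¹) ∷ colour b (p ⁻¹) ∷ colour c p ∷ colour a p ∷ []

by-parity : {P : Parity → Set} → P 0ℙ → P 1ℙ → ∀ p → P p
by-parity p0 _  0ℙ = p0
by-parity _  p1 1ℙ = p1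

colour-flip-≢ : ∀ b p → colour b p ≢ colour b (p ⁻¹)
colour-flip-≢ A = by-parity (λ ()) (λ ())
colour-flip-≢ B = by-parity (λ ()) (λ ())
colour-flip-≢ C = by-parity (λ ()) (λ ())
colour-flip-≢ D = by-parity (λ ()) (λ ())
colour-flip-≢ E = by-parity (λ ()) (λ ())

colour-step-≢ : ∀ {a b} → a ↝ b → ∀ p → colour a p ≢ colour b p
colour-step-≢ E↝D = by-parity (λ ()) (λ ())
colour-step-≢ D↝C = by-parity (λ ()) (λ ())
colour-step-≢ C↝B = by-parity (λ ()) (λ ())
colour-step-≢ B↝A = by-parity (λ ()) (λ ())
colour-step-≢ A↝B = by-parity (λ ()) (λ ())
colour-step-≢ A↝E = by-parity (λ ()) (λ ())

window-flip-distinguishable : ∀ {a b c} → a ↝ b → b ↝ c → ∀ p →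
                              Distinguishable (window a b c p) (window a b c (p ⁻¹))
window-flip-distinguishable E↝D D↝C = by-parity (distinguish _) (distinguish _)
window-flip-distinguishable D↝C C↝B = by-parity (distinguish _) (distinguish _)
window-flip-distinguishable C↝B B↝A = by-parity (distinguish _) (distinguish _)
window-flip-distinguishable B↝A A↝B = by-parity (distinguish _) (distinguish _)
window-flip-distinguishable B↝A A↝E = by-parity (distinguish _) (distinguish _)
window-flip-distinguishable A↝B B↝A = by-parity (distinguish _) (distinguish _)
window-flip-distinguishable A↝E E↝D = by-parity (distinguish _) (distinguish _)

window-shift-distinguishable : ∀ {a b c d} → a ↝ b → b ↝ c → c ↝ d → ∀ p →
                               Distinguishable (window a b c p) (window b c d p)
window-shift-distinguishable E↝D D↝C C↝B = by-parity (distinguish _) (distinguish _)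
window-shift-distinguishable D↝C C↝B B↝A = by-parity (distinguish _) (distinguish _)
window-shift-distinguishable C↝B B↝A A↝B = by-parity (distinguish _) (distinguish _)
window-shift-distinguishable C↝B B↝A A↝E = by-parity (distinguish _) (distinguish _)
window-shift-distinguishable B↝A A↝B B↝A = by-parity (distinguish _) (distinguish _)
window-shift-distinguishable B↝A A↝E E↝D = by-parity (distinguish _) (distinguish _)
window-shift-distinguishable A↝B B↝A A↝B = by-parity (distinguish _) (distinguish _)
window-shift-distinguishable A↝B B↝A A↝E = by-parity (distinguish _) (distinguish _)
window-shift-distinguishable A↝E E↝D D↝C = by-parity (distinguish _) (distinguish _)

module _ {m n : ℕ} (m-odd : suc m % 2 ≡ 1) (4≤m : 4 ≤ m) (n-even : suc n % 2 ≡ 0) where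

  private
    G = Torus m n

  stripeAt : Fin (suc m) → Stripe
  stripeAt i = stripe (toℕ i)

  phase : Fin (suc n) → Parity
  phase j = parity (toℕ j)

  colouring : V G → Fin 4
  colouring (i , j) = colour (stripeAt i) (phase j)

  stripe-next : ∀ i → stripeAt i ↝ stripeAt (next i)
  stripe-next = along-next _↝_ stripe stripe-step
                           (subst (_↝ E) (sym (stripe-even m m-odd 4≤m)) A↝E)

  stripe-prev : ∀ i → stripeAt (prev i) ↝ stripeAt i
  stripe-prev i = subst (λ i′ → stripeAt (prev i) ↝ stripeAt i′) (next-prev i) (stripe-next (prev i))

  phase-next : ∀ j → phase (next j) ≡ phase j ⁻¹
  phase-next = along-next (λ p q → q ≡ p ⁻¹) parity parity-suc
                          (sym (cong _⁻¹ (parity-pred-even n n-even)))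

  phase-prev : ∀ j → phase (prev j) ≡ phase j ⁻¹
  phase-prev j =
    sym (⁻¹-selfInverse (trans (sym (phase-next (prev j))) (cong phase (next-prev j))))

  nbr-colours : ∀ i j → map colouring (nbrs (i , j)) ≡
                        window (stripeAt (prev i)) (stripeAt i) (stripeAt (next i)) (phase j)
  nbr-colours i j rewrite phase-next j | phase-prev j = refl

  nbr-colours-next-row : ∀ i j → map colouring (nbrs (i , next j)) ≡
                         window (stripeAt (prev i)) (stripeAt i) (stripeAt (next i)) (phase j ⁻¹)
  nbr-colours-next-row i j rewrite sym (phase-next j) = nbr-colours i (next j)

  nbr-colours-next-column : ∀ i j → map colouring (nbrs (next i , j)) ≡
                            window (stripeAt i) (stripeAt (next i)) (stripeAt (next (next i))) (phase j)
  nbr-colours-next-column i j = trans (nbr-colours (next i) j) (cong shifted (prev-next i))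
    where
    shifted : Fin (suc m) → List (Fin 4)
    shifted i′ = window (stripeAt i′) (stripeAt (next i)) (stripeAt (next (next i))) (phase j)

  colouring-proper : Proper G colouring
  colouring-proper _ _ =
    edge-ind (λ u v → colouring u ≢ colouring v) (_∘ sym) vertical horizontal
    where
    vertical : ∀ i j → colouring (i , j) ≢ colouring (i , next j)
    vertical i j eq =
      colour-flip-≢ (stripeAt i) (phase j) (trans eq (cong (colour (stripeAt i)) (phase-next j)))
    horizontal : ∀ i j → colouring (i , j) ≢ colouring (next i , j)
    horizontal i j = colour-step-≢ (stripe-next i) (phase j)

  colouring-lid : ∀ u v → Adj G u v → ¬ SameN G u v → ¬ SameColors G colouring u v
  colouring-lid _ _ u~v _ =
    edge-ind (λ u v → ¬ SameColors G colouring u v) flip vertical horizontal u~v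
    where
    flip : ∀ {u v} → ¬ SameColors G colouring u v → ¬ SameColors G colouring v u
    flip ¬same same = ¬same λ c → Equiv.sym (same c)
    ¬same : ∀ {u v} → Distinguishable (map colouring (nbrs u)) (map colouring (nbrs v)) →
            ¬ SameColors G colouring u v
    ¬same = distinguishable⇒¬sameColors G nbrs nbrs-spec colouring
    vertical : ∀ i j → ¬ SameColors G colouring (i , j) (i , next j)
    vertical i j =
      ¬same (subst₂ Distinguishable (sym (nbr-colours i j)) (sym (nbr-colours-next-row i j))
                    (window-flip-distinguishable (stripe-prev i) (stripe-next i) (phase j)))
    horizontal : ∀ i j → ¬ SameColors G colouring (i , j) (next i , j)
    horizontal i j =
      ¬same (subst₂ Distinguishable (sym (nbr-colours i j)) (sym (nbr-colours-next-column i j))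
                    (window-shift-distinguishable (stripe-prev i) (stripe-next i) (stripe-next (next i))
                                                  (phase j)))

  colouring-isLid : IsLidColoring G 4 colouring
  colouring-isLid = colouring-proper , colouring-lid

lemma9 : (m n : ℕ) → 5 ≤ m → m % 2 ≡ 1 → 4 ≤ n → n % 2 ≡ 0 →
         χlid≡ (Cycle m □ Cycle n) 4
lemma9 (suc (suc m)) (suc (suc n)) (s≤s 4≤m) m-odd _ n-even =
  (colouring m-odd 4≤m n-even , colouring-isLid m-odd 4≤m n-even) , no-lid-colouring-below-4 m-odd
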